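{- Let $T$ be a finite tree with at least two vertices. When Tron is played rationally on $T$, we have $\mathcal{A} \leq \mathcal{B} + 1$ and $\mathcal{B} \leq 2\,\mathcal{A}$.
   Context: Tron on an undirected graph $G$ is a two-player game with complete information. The first player (Alice) picks a start vertex; then the second player (Bob) picks a different start vertex. The players then alternate turns, Alice first; in a turn a player moves from his or her current vertex to an adjacent vertex that has not yet been visited by either player (start vertices count as visited). A player with no legal move is skipped, and the game ends when neither player can move. $\mathcal{A}$ and $\mathcal{B}$ denote the numbers of vertices traversed (including the start vertex) by Alice and Bob respectively, and the outcome of the game is $\mathcal{B}/\mathcal{A}$. Rational play means Bob plays to maximize the outcome and Alice plays to minimize it. -}

module Defs where

open import Data.Nat using (ℕ; zero; suc; _+_; _*_; _∸_; _≤_)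
open import Data.Integer using (+_)
open import Data.Rational using (ℚ; _/_; _⊓_; _⊔_; 0ℚ)
open import Data.Bool using (Bool; true; false; not; _∧_; if_then_else_)
open import Data.Fin using (Fin; _≟_)
open import Data.List using (List; []; _∷_; _++_; [_]; filterᵇ; allFin; map; length)
open import Data.List.Membership.Propositional using (_∈_)
open import Data.List.Relation.Unary.Linked using (Linked)
open import Data.List.Relation.Unary.Unique.Propositional using (Unique)
open import Data.Product using (Σ; _×_; ∃; ∃-syntax)
open import Relation.Binary.PropositionalEquality using (_≡_; _≢_)
open import Relation.Nullary using (¬_)
open import Relation.Nullary.Decidable using (⌊_⌋)

record Graph (n : ℕ) : Set where
  field
    adj      : Fin n → Fin n → Bool
    adj-sym  : ∀ u v → adj u v ≡ adj v u
    loopless : ∀ v → adj v v ≡ false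
open Graph public

module _ {n : ℕ} (G : Graph n) where

  Adj : Fin n → Fin n → Set
  Adj u v = adj G u v ≡ true

  IsPath : List (Fin n) → Set
  IsPath vs = Unique vs × Linked Adj vs

  PathFromTo : Fin n → Fin n → List (Fin n) → Set
  PathFromTo u v vs = IsPath vs × Σ (List (Fin n)) (λ rest → vs ≡ u ∷ rest)
                               × Σ (List (Fin n)) (λ ini → vs ≡ ini ++ [ v ])

  Connected : Set
  Connected = ∀ u v → ∃[ vs ] PathFromTo u v vs

  IsCycle : List (Fin n) → Set
  IsCycle vs = IsPath vs × 3 ≤ length vs
             × Σ (Fin n) (λ v0 → Σ (List (Fin n)) (λ rest → Σ (Fin n) (λ vk → Σ (List (Fin n)) (λ ini →
                 vs ≡ v0 ∷ rest × vs ≡ ini ++ [ vk ] × Adj vk v0))))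

  Acyclic : Set
  Acyclic = ∀ vs → ¬ IsCycle vs

  IsTree : Set
  IsTree = Connected × Acyclic

record State (n : ℕ) : Set where
  constructor st
  field
    visited   : Fin n → Bool
    posA posB : Fin n
    aliceTurn : Bool      -- true: Alice is to move
    cntA cntB : ℕ         -- vertices traversed so far (start vertices included)
open State public

module Tron {n : ℕ} (G : Graph n) where

  movesFrom : (Fin n → Bool) → Fin n → List (Fin n)
  movesFrom vis p = filterᵇ (λ v → adj G p v ∧ not (vis v)) (allFin n)

  hasMoves : (Fin n → Bool) → Fin n → Bool
  hasMoves vis p with movesFrom vis p
  ... | []    = false
  ... | _ ∷ _ = true

  curPos : State n → Fin n
  curPos s = if aliceTurn s then posA s else posB s

  movesCur : State n → List (Fin n)
  movesCur s = movesFrom (visited s) (curPos s)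

  -- hand the turn to player t (true = Alice) unless t has no legal move,
  -- in which case t is skipped
  giveTurn : (Fin n → Bool) → Fin n → Fin n → Bool → Bool
  giveTurn vis a b true  = if hasMoves vis a then true  else false
  giveTurn vis a b false = if hasMoves vis b then false else true

  mark : (Fin n → Bool) → Fin n → Fin n → Bool
  mark vis v w = if ⌊ w ≟ v ⌋ then true else vis w

  step : State n → Fin n → State n
  step (st vis a b true  ca cb) v =
    st (mark vis v) v b (giveTurn (mark vis v) v b false) (suc ca) cb
  step (st vis a b false ca cb) v =
    st (mark vis v) a v (giveTurn (mark vis v) a v true) ca (suc cb)

  initial : Fin n → Fin n → State n
  initial a b = st vis a b (giveTurn vis a b true) 1 1
    where vis = λ w → ⌊ w ≟ a ⌋ ∨' ⌊ w ≟ b ⌋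
            where _∨'_ : Bool → Bool → Bool
                  true  ∨' _ = true
                  false ∨' y = y

  -- the outcome B/A (A ≥ 1 always, since the start vertex is counted)
  outcome : State n → ℚ
  outcome s = (+ cntB s) / suc (cntA s ∸ 1)

  minOver maxOver : {A : Set} → List A → (A → ℚ) → ℚ
  minOver []       f = 0ℚ
  minOver (x ∷ []) f = f x
  minOver (x ∷ xs@(_ ∷ _)) f = f x ⊓ minOver xs f
  maxOver []       f = 0ℚ
  maxOver (x ∷ []) f = f x
  maxOver (x ∷ xs@(_ ∷ _)) f = f x ⊔ maxOver xs f

  -- value of a position under rational play (Alice minimises, Bob maximises),
  -- computed with k moves of look-ahead; k = n suffices for the whole game,
  -- since every move visits a new vertex
  value : ℕ → State n → ℚ
  value zero    s = outcome s
  value (suc k) s with movesCur s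
  ... | [] = outcome s
  ... | ms@(_ ∷ _) = if aliceTurn s then minOver ms (λ v → value k (step s v))
                                    else maxOver ms (λ v → value k (step s v))

  startValue : Fin n → ℚ
  startValue a = maxOver (filterᵇ (λ b → not ⌊ b ≟ a ⌋) (allFin n)) (λ b → value n (initial a b))

  data RationalRun : ℕ → State n → State n → Set where
    finished : ∀ {k s} → movesCur s ≡ [] → RationalRun k s s
    move     : ∀ {k s f} v → v ∈ movesCur s →
               value k (step s v) ≡ value (suc k) s →
               RationalRun k (step s v) f → RationalRun (suc k) s f

  RationalPlay : ℕ → ℕ → Set
  RationalPlay A B =
    Σ (Fin n) λ a → Σ (Fin n) λ b →
      a ≢ b
    × startValue a ≡ minOver (allFin n) startValue
    × value n (initial a b) ≡ startValue a
    × Σ (State n) λ f → RationalRun n (initial a b) f × cntA f ≡ A × cntB f ≡ B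

-- The value of a position (Tron.value: Alice minimises, Bob maximises the outcome B/A) is compared
-- with what a simple strategy guarantees. The common tool is a safe route: a path of free vertices
-- leaving a player's vertex that the opponent cannot reach through free vertices. A player can follow
-- a safe route whatever the opponent does (AliceFollowsRoute, BobFollowsRoute), and in a tree safe
-- routes come from the fact that deleting a vertex separates its neighbours (tree-separation).
--   * A ≤ B + 1: against Alice's start a, Bob starts next to a on a longest path Q from a and walks
--     along it. He gets |Q| - 1 vertices, Alice at most |Q| (her trail is a path from a), so the value
--     of a is at least (|Q| - 1)/|Q|  (bob-follows-longest-path).
--   * B ≤ 2A: Alice may start at the middle vertex c of a longest path P. Bob's start cuts off at most
--     one side of c, so Alice gets about half of P while Bob gets at most |P|: the value of c is at most
--     2, hence so is the value of an optimal start  (alice-takes-middle).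
-- Under rational play the final outcome is the value of Alice's start (value-run), which gives both
-- bounds.
module Submission where

open import Defs

open import Data.Bool using (Bool; true; false; not; _∧_; T)
import Data.Bool.Properties as Bool
open import Data.Empty using (⊥)
open import Data.Fin using (Fin; _≟_)
import Data.Fin.Properties as Fin
open import Data.Integer using (+_; +≤+) renaming (_≤_ to _≤ℤ_)
import Data.Integer.Properties as ℤ
open import Data.List using (List; []; _∷_; _++_; [_]; length; lookup; reverse; _ʳ++_; map; concatMap; filter; filterᵇ; allFin)
open import Data.List.Extrema.Nat using (argmax; argmax-all; f[xs]≤f[argmax])
open import Data.List.Membership.Propositional using (_∈_; _∉_)
open import Data.List.Membership.Propositional.Properties using (∈-lookup; ∈-∃++; ∈-concatMap⁺; ∈-map⁺; ∈-allFin; ∈-filter⁺; ∈-filter⁻)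
open import Data.List.Properties using (∷-injectiveˡ; ∷-injectiveʳ; unfold-reverse; length-++; reverse-++; length-reverse; ++-assoc)
open import Data.List.Relation.Binary.Disjoint.Propositional using (Disjoint)
import Data.List.Relation.Binary.Disjoint.Propositional.Properties as Disjoint
open import Data.List.Relation.Unary.All as All using (All; []; _∷_)
open import Data.List.Relation.Unary.All.Properties using (++⁻ˡ; ++⁻ʳ; all-filter)
open import Data.List.Relation.Unary.All.Properties.Core using (¬Any⇒All¬)
open import Data.List.Relation.Unary.AllPairs as AllPairs using (AllPairs; []; _∷_)
import Data.List.Relation.Unary.AllPairs.Properties as AllPairs
open import Data.List.Relation.Unary.Any as Any using (here; there; any?)
import Data.List.Relation.Unary.Any.Properties as Any
open import Data.List.Relation.Unary.Linked as Linked using (Linked; []; [-]; _∷_; linked?)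
open import Data.List.Relation.Unary.Unique.DecPropositional using (unique?)
open import Data.List.Relation.Unary.Unique.Propositional using (Unique)
import Data.List.Relation.Unary.Unique.Propositional.Properties as Unique
open import Data.Nat using (ℕ; zero; suc; _+_; _*_; _∸_; _≤_; _<_; z≤n; s≤s; z<s; ⌊_/2⌋; ⌈_/2⌉)
import Data.Nat.Properties as ℕ
import Data.Product as Product
open import Data.Product using (_×_; _,_; proj₁; proj₂; ∃; ∃₂)
open import Data.Rational using (ℚ; _/_) renaming (_≤_ to _≤ℚ_)
import Data.Rational.Properties as ℚ
open import Data.Rational.Unnormalised using (mkℚᵘ; *≤*)
import Data.Rational.Unnormalised.Properties as ℚᵘ
open import Data.Sum using (_⊎_; inj₁; inj₂)
open import Data.Unit using (tt)
open import Function using (_∘_; case_of_)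
open import Level using (0ℓ)
open import Relation.Binary.Core using (Rel)
open import Relation.Binary.Definitions using (Symmetric)
open import Relation.Binary.PropositionalEquality
  using (_≡_; _≢_; ≢-sym; refl; sym; trans; cong; cong₂; subst; subst₂; module ≡-Reasoning)
open import Relation.Nullary using (¬_; yes; no; contradiction)
open import Relation.Nullary.Decidable using (_×-dec_; ⌊_⌋; decidable-stable)
open import Relation.Unary using (Decidable)

⌈n/2⌉≤1+⌊n/2⌋ : ∀ k → ⌈ k /2⌉ ≤ suc ⌊ k /2⌋
⌈n/2⌉≤1+⌊n/2⌋ 0 = z≤n
⌈n/2⌉≤1+⌊n/2⌋ 1 = s≤s z≤n
⌈n/2⌉≤1+⌊n/2⌋ (suc (suc k)) = s≤s (⌈n/2⌉≤1+⌊n/2⌋ k)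

target-step : ∀ {target c R R′ : ℕ} → target ≤ c + R → R ≤ suc R′ → target ≤ suc c + R′
target-step {c = c} {R′ = R′} reached shorter =
  ℕ.≤-trans reached (ℕ.≤-trans (ℕ.+-monoʳ-≤ c shorter) (ℕ.≤-reflexive (ℕ.+-suc c R′)))

ratio-≤ : ∀ a b c d → a * suc d ≤ c * suc b → + a / suc b ≤ℚ + c / suc d
ratio-≤ a b c d cross = ℚ.toℚᵘ-cancel-≤
  (ℚᵘ.≤-respˡ-≃ (ℚᵘ.≃-sym (ℚ.toℚᵘ-fromℚᵘ (mkℚᵘ (+ a) b)))
    (ℚᵘ.≤-respʳ-≃ (ℚᵘ.≃-sym (ℚ.toℚᵘ-fromℚᵘ (mkℚᵘ (+ c) d)))
      (*≤* (subst₂ _≤ℤ_ (ℤ.pos-* a (suc d)) (ℤ.pos-* c (suc b)) (+≤+ cross)))))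

ratio-≤⁻ : ∀ a b c d → + a / suc b ≤ℚ + c / suc d → a * suc d ≤ c * suc b
ratio-≤⁻ a b c d le
  with ℚᵘ.≤-respˡ-≃ (ℚ.toℚᵘ-fromℚᵘ (mkℚᵘ (+ a) b)) (ℚᵘ.≤-respʳ-≃ (ℚ.toℚᵘ-fromℚᵘ (mkℚᵘ (+ c) d)) (ℚ.toℚᵘ-mono-≤ le))
... | *≤* cross with subst₂ _≤ℤ_ (sym (ℤ.pos-* a (suc d))) (sym (ℤ.pos-* c (suc b))) cross
...   | +≤+ cross′ = cross′

near-one-ratio : ∀ {L x B} → x ≤ L → L * suc x ≤ B * suc L → x ≤ B
near-one-ratio {L} {x} {B} x≤L cross with x ℕ.≤? B
... | yes x≤B = x≤B
... | no x≰B = contradiction (ℕ.≤-trans x≤L (ℕ.≤-trans (ℕ.m≤m+n L L) 2L≤B)) x≰B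
  where
  B<x : B < x
  B<x = ℕ.≰⇒> x≰B
  2L≤B : L + L ≤ B
  2L≤B = ℕ.+-cancelʳ-≤ (L * B) (L + L) B (begin
    L + L + L * B     ≡⟨ ℕ.+-assoc L L (L * B) ⟩
    L + (L + L * B)   ≡⟨ cong (λ y → L + y) (sym (ℕ.*-suc L B)) ⟩
    L + L * suc B     ≡⟨ sym (ℕ.*-suc L (suc B)) ⟩
    L * suc (suc B)   ≤⟨ ℕ.*-monoʳ-≤ L (s≤s B<x) ⟩
    L * suc x         ≤⟨ cross ⟩
    B * suc L         ≡⟨ ℕ.*-suc B L ⟩
    B + B * L         ≡⟨ cong (λ y → B + y) (ℕ.*-comm B L) ⟩
    B + L * B         ∎)
    where open ℕ.≤-Reasoning

module _ {A : Set} where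

  unique-lookup-injective : ∀ {xs : List A} → Unique xs → ∀ i j → lookup xs i ≡ lookup xs j → i ≡ j
  unique-lookup-injective (_ ∷ _) Fin.zero Fin.zero _ = refl
  unique-lookup-injective (px ∷ _) Fin.zero (Fin.suc j) eq = contradiction eq (All.lookup px (∈-lookup j))
  unique-lookup-injective (px ∷ _) (Fin.suc i) Fin.zero eq = contradiction (sym eq) (All.lookup px (∈-lookup i))
  unique-lookup-injective (_ ∷ u) (Fin.suc i) (Fin.suc j) eq = cong Fin.suc (unique-lookup-injective u i j eq)

  unique-++-distinct : ∀ xs {ys : List A} {x y} → Unique (xs ++ ys) → x ∈ xs → y ∈ ys → x ≢ y
  unique-++-distinct (_ ∷ xs) (px ∷ _) (here refl) y∈ = All.lookup (++⁻ʳ xs px) y∈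
  unique-++-distinct (_ ∷ xs) (_ ∷ u) (there x∈) y∈ = unique-++-distinct xs u x∈ y∈

  suffix-ends : ∀ pre {x : A} {suf ini y} → pre ++ x ∷ suf ≡ ini ++ [ y ] →
                ∃ λ ini′ → x ∷ suf ≡ ini′ ++ [ y ]
  suffix-ends [] eq = _ , eq
  suffix-ends (_ ∷ pre) {ini = _ ∷ ini} eq = suffix-ends pre (∷-injectiveʳ eq)
  suffix-ends (_ ∷ [])      {ini = []} ()
  suffix-ends (_ ∷ _ ∷ _)   {ini = []} ()

  ends-distinct-long : ∀ {x y : A} rest ini → x ≢ y → x ∷ rest ≡ ini ++ [ y ] → 2 ≤ length (x ∷ rest)
  ends-distinct-long (_ ∷ _) _ _ _ = s≤s (s≤s z≤n)
  ends-distinct-long [] [] x≢y ends = contradiction (∷-injectiveˡ ends) x≢y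
  ends-distinct-long [] (_ ∷ []) _ ()
  ends-distinct-long [] (_ ∷ _ ∷ _) _ ()

  empty-or-member : ∀ (xs : List A) → xs ≡ [] ⊎ ∃ (_∈ xs)
  empty-or-member [] = inj₁ refl
  empty-or-member (x ∷ _) = inj₂ (x , here refl)

  split-at : ∀ m (xs : List A) → m < length xs →
             ∃₂ λ pre c → ∃ λ suf → xs ≡ pre ++ c ∷ suf × length pre ≡ m
  split-at zero (c ∷ suf) _ = [] , c , suf , refl , refl
  split-at (suc m) (x ∷ xs) (s≤s m<) with split-at m xs m<
  ... | pre , c , suf , split , len = x ∷ pre , c , suf , cong (x ∷_) split , cong suc len

  middle-split : ∀ (x : A) xs → ∃₂ λ pre c → ∃ λ suf →
                 x ∷ xs ≡ pre ++ c ∷ suf × length pre ≤ length suf × length suf ≤ suc (length pre)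
  middle-split x xs with split-at ⌊ length xs /2⌋ (x ∷ xs) (s≤s (ℕ.⌊n/2⌋≤n (length xs)))
  ... | pre , c , suf , split , left =
    pre , c , suf , split ,
    subst₂ _≤_ (sym left) right (ℕ.⌊n/2⌋≤⌈n/2⌉ (length xs)) ,
    subst₂ (λ r l → r ≤ suc l) right (sym left) (⌈n/2⌉≤1+⌊n/2⌋ (length xs))
    where
    right : ⌈ length xs /2⌉ ≡ length suf
    right = ℕ.+-cancelˡ-≡ (length pre) _ _ (ℕ.suc-injective (begin
      suc (length pre + ⌈ length xs /2⌉) ≡⟨ cong (λ l → suc (l + ⌈ length xs /2⌉)) left ⟩
      suc (⌊ length xs /2⌋ + ⌈ length xs /2⌉) ≡⟨ cong suc (ℕ.⌊n/2⌋+⌈n/2⌉≡n (length xs)) ⟩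
      length (x ∷ xs)                     ≡⟨ cong length split ⟩
      length (pre ++ c ∷ suf)             ≡⟨ length-++ pre ⟩
      length pre + suc (length suf)       ≡⟨ ℕ.+-suc (length pre) (length suf) ⟩
      suc (length pre + length suf)       ∎))
      where open ≡-Reasoning

  module _ {R : Rel A 0ℓ} where

    allPairs-prefix : ∀ xs {ys} → AllPairs R (xs ++ ys) → AllPairs R xs
    allPairs-prefix [] _ = []
    allPairs-prefix (_ ∷ xs) (px ∷ p) = ++⁻ˡ xs px ∷ allPairs-prefix xs p

    allPairs-suffix : ∀ xs {ys} → AllPairs R (xs ++ ys) → AllPairs R ys
    allPairs-suffix [] p = p
    allPairs-suffix (_ ∷ xs) (_ ∷ p) = allPairs-suffix xs p

    linked-prefix : ∀ xs {ys} → Linked R (xs ++ ys) → Linked R xs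
    linked-prefix [] _ = []
    linked-prefix (_ ∷ []) _ = [-]
    linked-prefix (_ ∷ _ ∷ xs) (r ∷ l) = r ∷ linked-prefix (_ ∷ xs) l

    linked-suffix : ∀ xs {ys} → Linked R (xs ++ ys) → Linked R ys
    linked-suffix [] l = l
    linked-suffix (_ ∷ xs) l = linked-suffix xs (Linked.tail l)

    reverse-allPairs : Symmetric R → ∀ {xs} → AllPairs R xs → AllPairs R (reverse xs)
    reverse-allPairs R-sym [] = []
    reverse-allPairs R-sym {x ∷ xs} (px ∷ p) =
      subst (AllPairs R) (sym (unfold-reverse x xs))
        (AllPairs.++⁺ (reverse-allPairs R-sym p) ([] ∷ [])
          (All.tabulate (λ y∈ → R-sym (All.lookup px (Any.reverse⁻ y∈)) ∷ [])))

    linked-ʳ++ : Symmetric R → ∀ {x xs acc} → Linked R (x ∷ xs) → Linked R (x ∷ acc) → Linked R (xs ʳ++ x ∷ acc)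
    linked-ʳ++ R-sym {xs = []} _ l = l
    linked-ʳ++ R-sym {xs = _ ∷ _} (r ∷ l) l′ = linked-ʳ++ R-sym l (R-sym r ∷ l′)

    reverse-linked : Symmetric R → ∀ {xs} → Linked R xs → Linked R (reverse xs)
    reverse-linked R-sym [] = []
    reverse-linked R-sym {_ ∷ _} l = linked-ʳ++ R-sym l [-]

unique-length≤ : ∀ {n} {xs : List (Fin n)} → Unique xs → length xs ≤ n
unique-length≤ {n} {xs} u with length xs ℕ.≤? n
... | yes le = le
... | no gt with Fin.pigeonhole (ℕ.≰⇒> gt) (lookup xs)
... | i , j , i<j , eq = contradiction (unique-lookup-injective u i j eq) (Fin.<⇒≢ i<j)

module _ {n : ℕ} where

  listsUpTo : ℕ → List (List (Fin n))
  listsUpTo zero = [ [] ]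
  listsUpTo (suc k) = [] ∷ concatMap (λ x → map (x ∷_) (listsUpTo k)) (allFin n)

  ∈-listsUpTo : ∀ k xs → length xs ≤ k → xs ∈ listsUpTo k
  ∈-listsUpTo zero [] _ = here refl
  ∈-listsUpTo (suc k) [] _ = here refl
  ∈-listsUpTo (suc k) (x ∷ xs) (s≤s len) =
    there (∈-concatMap⁺ (λ y → map (y ∷_) (listsUpTo k))
            (Any.map (λ { refl → ∈-map⁺ (x ∷_) (∈-listsUpTo k xs len) }) (∈-allFin x)))

  -- a decidable property of duplicate-free vertex lists that holds somewhere has a longest witness:
  -- such lists have at most n entries, so a maximum over the finite list listsUpTo n is one
  longest : (P : List (Fin n) → Set) → Decidable P → (∀ {xs} → P xs → Unique xs) → ∀ {x₀} → P x₀ →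
            ∃ λ xs → P xs × (∀ {ys} → P ys → length ys ≤ length xs)
  longest P P? unique {x₀} p₀ =
    argmax length x₀ candidates , argmax-all length p₀ (all-filter P? (listsUpTo n)) ,
    λ {ys} pys → All.lookup (f[xs]≤f[argmax] x₀ candidates)
                   (∈-filter⁺ P? (∈-listsUpTo n ys (unique-length≤ (unique pys))) pys)
    where
    candidates = filter P? (listsUpTo n)

module Paths {n : ℕ} (G : Graph n) where

  Adj-sym : ∀ {u v} → Adj G u v → Adj G v u
  Adj-sym {u} {v} uv = trans (adj-sym G v u) uv

  Adj-irrefl : ∀ {u v} → Adj G u v → u ≢ v
  Adj-irrefl {u} uv refl with trans (sym uv) (loopless G u)
  ... | ()

  reverse-path : ∀ {xs} → IsPath G xs → IsPath G (reverse xs)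
  reverse-path (u , l) = reverse-allPairs ≢-sym u , reverse-linked Adj-sym l

  path-prefix : ∀ xs {ys} → IsPath G (xs ++ ys) → IsPath G xs
  path-prefix xs (u , l) = allPairs-prefix xs u , linked-prefix xs l

  path-suffix : ∀ xs {ys} → IsPath G (xs ++ ys) → IsPath G ys
  path-suffix xs (u , l) = allPairs-suffix xs u , linked-suffix xs l

  -- Walk P x y: a walk from x to y all of whose vertices after x satisfy P
  data Walk (P : Fin n → Set) : Fin n → Fin n → Set where
    stay : ∀ {x} → Walk P x x
    go : ∀ {x z y} → Adj G x z → P z → Walk P z y → Walk P x y

  module _ {P : Fin n → Set} where

    _++ʷ_ : ∀ {x y z} → Walk P x y → Walk P y z → Walk P x z
    stay ++ʷ w′ = w′
    go a pz w ++ʷ w′ = go a pz (w ++ʷ w′)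

    walk-reverse : ∀ {x y} → P x → Walk P x y → Walk P y x
    walk-reverse px stay = stay
    walk-reverse px (go a pz w) = walk-reverse pz w ++ʷ go (Adj-sym a) px stay

    walk-weaken : ∀ {Q : Fin n → Set} → (∀ {z} → P z → Q z) → ∀ {x y} → Walk P x y → Walk Q x y
    walk-weaken P⇒Q stay = stay
    walk-weaken P⇒Q (go a pz w) = go a (P⇒Q pz) (walk-weaken P⇒Q w)

    linked-walk : ∀ {x xs y} → Linked (Adj G) (x ∷ xs) → All P xs → y ∈ x ∷ xs → Walk P x y
    linked-walk l ps (here refl) = stay
    linked-walk (a ∷ l) (pz ∷ ps) (there y∈) = go a pz (linked-walk l ps y∈)

    walk-path : ∀ {x y} → P x → Walk P x y → ∃ λ vs → PathFromTo G x y vs × All P vs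
    walk-path px (stay {x}) = [ x ] , ((([] ∷ []) , [-]) , ([] , refl) , ([] , refl)) , px ∷ []
    walk-path {x} px (go a pz w) with walk-path pz w
    ... | vs , ((u , l) , (rest , refl) , (ini , ends)) , ps with any? (x ≟_) vs
    ...   | no x∉ = x ∷ vs , (((¬Any⇒All¬ vs x∉ ∷ u) , a ∷ l) , (vs , refl) , (x ∷ ini , cong (x ∷_) ends)) , px ∷ ps
    ...   | yes x∈ with ∈-∃++ x∈
    ...     | pre , suf , split =
      x ∷ suf
      , (path-suffix pre (subst (IsPath G) split (u , l)) , (suf , refl) , suffix-ends pre (trans (sym split) ends))
      , ++⁻ʳ pre (subst (All P) split ps)

  -- in an acyclic graph, deleting a vertex c separates any two of its neighbours u, w:
  -- a walk from u to w avoiding c shortens to a path u … w, which c closes to a cycle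
  tree-separation : Acyclic G → ∀ {c u w} → Adj G c u → Adj G c w → u ≢ w → ¬ Walk (_≢ c) u w
  tree-separation acyclic {c} {u} {w} cu cw u≢w walk
    with walk-path (λ u≡c → Adj-irrefl cu (sym u≡c)) walk
  ... | vs , ((uniq , linked) , (rest , refl) , (ini , ends)) , avoid =
    acyclic (c ∷ vs) (((All.map ≢-sym avoid ∷ uniq) , cu ∷ linked) , s≤s (ends-distinct-long rest ini u≢w ends)
                     , c , vs , w , c ∷ ini , refl , cong (c ∷_) ends , Adj-sym cw)

  branches-separated : Acyclic G → ∀ {c U W x y} → IsPath G (c ∷ U) → IsPath G (c ∷ W) → Disjoint U W →
                       x ∈ U → y ∈ W → ¬ Walk (_≢ c) x y
  branches-separated acyclic {U = u ∷ _} {W = w ∷ _} ((c∉U ∷ _) , cu ∷ lU) ((c∉W ∷ _) , cw ∷ lW) disj x∈ y∈ x⇝y =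
    tree-separation acyclic cu cw (λ { refl → disj (here refl , here refl) })
      (linked-walk lU (avoid (All.tail c∉U)) x∈ ++ʷ (x⇝y ++ʷ walk-reverse (≢-sym (All.head c∉W)) (linked-walk lW (avoid (All.tail c∉W)) y∈)))
    where
    avoid : ∀ {c zs} → All (c ≢_) zs → All (_≢ c) zs
    avoid = All.map ≢-sym

  StartsAt : Fin n → List (Fin n) → Set
  StartsAt a xs = ∃ λ rest → xs ≡ a ∷ rest

  PathFrom : Fin n → List (Fin n) → Set
  PathFrom a xs = IsPath G xs × StartsAt a xs

  isPath? : Decidable (IsPath G)
  isPath? xs = unique? _≟_ xs ×-dec linked? (λ x y → adj G x y Bool.≟ true) xs

  startsAt? : ∀ a → Decidable (StartsAt a)
  startsAt? a [] = no λ ()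
  startsAt? a (x ∷ xs) with x ≟ a
  ... | yes refl = yes (xs , refl)
  ... | no x≢a = no λ { (_ , refl) → x≢a refl }

module Game {n : ℕ} (G : Graph n) where
  open Tron G
  open Paths G

  Free Visited : (Fin n → Bool) → Fin n → Set
  Free    vis v = vis v ≡ false
  Visited vis v = vis v ≡ true

  ∈-movesFrom⁻ : ∀ {vis p v} → v ∈ movesFrom vis p → Adj G p v × Free vis v
  ∈-movesFrom⁻ {vis} {p} {v} v∈ = split (adj G p v) (vis v) (proj₂ (∈-filter⁻ (Bool.T? ∘ legal) {xs = allFin n} v∈))
    where
    legal = λ w → adj G p w ∧ not (vis w)
    split : ∀ x y → T (x ∧ not y) → x ≡ true × y ≡ false
    split true false _ = refl , refl

  ∈-movesFrom⁺ : ∀ {vis p v} → Adj G p v → Free vis v → v ∈ movesFrom vis p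
  ∈-movesFrom⁺ {vis} {p} {v} pv free =
    ∈-filter⁺ (Bool.T? ∘ λ w → adj G p w ∧ not (vis w)) (∈-allFin v) (subst₂ (λ x y → T (x ∧ not y)) (sym pv) (sym free) tt)

  mark-self : ∀ vis v → Visited (mark vis v) v
  mark-self vis v with v ≟ v
  ... | yes _ = refl
  ... | no v≢v = contradiction refl v≢v

  mark-other : ∀ vis {v w} → w ≢ v → mark vis v w ≡ vis w
  mark-other vis {v} {w} w≢v with w ≟ v
  ... | yes w≡v = contradiction w≡v w≢v
  ... | no _ = refl

  mark-visited : ∀ vis v {w} → Visited vis w → Visited (mark vis v) w
  mark-visited vis v {w} t with w ≟ v
  ... | yes _ = refl
  ... | no _ = t

  mark-free : ∀ vis v {w} → Free (mark vis v) w → Free vis w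
  mark-free vis v {w} f with w ≟ v
  ... | yes _ = case f of λ ()
  ... | no _ = f

  initial-visitedA : ∀ a b → visited (initial a b) a ≡ true
  initial-visitedA a b with a ≟ a
  ... | yes _ = refl
  ... | no a≢a = contradiction refl a≢a

  initial-visitedB : ∀ a b → visited (initial a b) b ≡ true
  initial-visitedB a b with b ≟ a | b ≟ b
  ... | yes _ | _ = refl
  ... | no _ | yes _ = refl
  ... | no _ | no b≢b = contradiction refl b≢b

  initial-free : ∀ a b {w} → w ≢ a → w ≢ b → Free (visited (initial a b)) w
  initial-free a b {w} w≢a w≢b with w ≟ a | w ≟ b
  ... | yes w≡a | _ = contradiction w≡a w≢a
  ... | no _ | yes w≡b = contradiction w≡b w≢b
  ... | no _ | no _ = refl

  -- thanks to the skip rule, the game only stops when both players are stuck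
  GameOverOnlyIfBothStuck : State n → Set
  GameOverOnlyIfBothStuck s =
    movesCur s ≡ [] → movesFrom (visited s) (posA s) ≡ [] × movesFrom (visited s) (posB s) ≡ []

  hasMoves-false : ∀ vis p → hasMoves vis p ≡ false → movesFrom vis p ≡ []
  hasMoves-false vis p h with movesFrom vis p
  ... | [] = refl
  hasMoves-false vis p () | _ ∷ _

  hasMoves-true : ∀ vis p → hasMoves vis p ≡ true → movesFrom vis p ≢ []
  hasMoves-true vis p h with movesFrom vis p
  hasMoves-true vis p () | []
  ... | _ ∷ _ = λ ()

  giveTurn-sound : ∀ vis a b t ca cb → GameOverOnlyIfBothStuck (st vis a b (giveTurn vis a b t) ca cb)
  giveTurn-sound vis a b true ca cb with hasMoves vis a in has
  ... | true = λ stuck → contradiction stuck (hasMoves-true vis a has)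
  ... | false = λ stuckB → hasMoves-false vis a has , stuckB
  giveTurn-sound vis a b false ca cb with hasMoves vis b in has
  ... | true = λ stuck → contradiction stuck (hasMoves-true vis b has)
  ... | false = λ stuckA → stuckA , hasMoves-false vis b has

  free⇒≢ : ∀ {vis x c} → Free vis x → Visited vis c → x ≢ c
  free⇒≢ free visitedC refl = case trans (sym free) visitedC of λ ()

  free-∉ : ∀ {vis v xs} → All (Visited vis) xs → Free vis v → v ∉ xs
  free-∉ visitedTrail free v∈ = case trans (sym free) (All.lookup visitedTrail v∈) of λ ()

  disjoint-∷ : ∀ {v : Fin n} {xs ys} → v ∉ ys → Disjoint xs ys → Disjoint (v ∷ xs) ys
  disjoint-∷ v∉ _ (here refl , v∈) = v∉ v∈
  disjoint-∷ _ disj (there x∈ , y∈) = disj (x∈ , y∈)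

  -- the invariant of every position reached from the start a of Alice: both players' trails
  -- (current vertex first) are disjoint visited paths, Alice's ending at a, and they are counted by cntA, cntB
  record History (a : Fin n) (s : State n) : Set where
    field
      pastA pastB : List (Fin n)
      pathA : IsPath G (posA s ∷ pastA)
      pathB : IsPath G (posB s ∷ pastB)
      disjoint : Disjoint (posA s ∷ pastA) (posB s ∷ pastB)
      visitedA : All (Visited (visited s)) (posA s ∷ pastA)
      visitedB : All (Visited (visited s)) (posB s ∷ pastB)
      startA : ∃ λ ini → posA s ∷ pastA ≡ ini ++ [ a ]
      countA : cntA s ≡ length (posA s ∷ pastA)
      countB : cntB s ≡ length (posB s ∷ pastB)
      over : GameOverOnlyIfBothStuck s

  history-initial : ∀ {a b} → a ≢ b → History a (initial a b)
  history-initial {a} {b} a≢b = record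
    { pastA = [] ; pastB = []
    ; pathA = ([] ∷ []) , [-] ; pathB = ([] ∷ []) , [-]
    ; disjoint = λ { (here refl , here refl) → a≢b refl }
    ; visitedA = initial-visitedA a b ∷ [] ; visitedB = initial-visitedB a b ∷ []
    ; startA = [] , refl ; countA = refl ; countB = refl
    ; over = giveTurn-sound _ a b true 1 1 }

  history-step : ∀ {a s v} → History a s → v ∈ movesCur s → History a (step s v)
  history-step {a} {st vis pa pb true ca cb} {v} h v∈ = record
    { pastA = pa ∷ pastA ; pastB = pastB
    ; pathA = (¬Any⇒All¬ _ v∉A ∷ proj₁ pathA) , Adj-sym pv ∷ proj₂ pathA
    ; pathB = pathB
    ; disjoint = disjoint-∷ v∉B disjoint
    ; visitedA = mark-self vis v ∷ All.map (mark-visited vis v) visitedA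
    ; visitedB = All.map (mark-visited vis v) visitedB
    ; startA = Product.map (v ∷_) (cong (v ∷_)) startA
    ; countA = cong suc countA ; countB = countB
    ; over = giveTurn-sound _ v pb false (suc ca) cb }
    where
    open History h
    pv = proj₁ (∈-movesFrom⁻ v∈)
    v∉A = free-∉ visitedA (proj₂ (∈-movesFrom⁻ v∈))
    v∉B = free-∉ visitedB (proj₂ (∈-movesFrom⁻ v∈))
  history-step {a} {st vis pa pb false ca cb} {v} h v∈ = record
    { pastA = pastA ; pastB = pb ∷ pastB
    ; pathA = pathA
    ; pathB = (¬Any⇒All¬ _ v∉B ∷ proj₁ pathB) , Adj-sym pv ∷ proj₂ pathB
    ; disjoint = Disjoint.sym (disjoint-∷ v∉A (Disjoint.sym disjoint))
    ; visitedA = All.map (mark-visited vis v) visitedA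
    ; visitedB = mark-self vis v ∷ All.map (mark-visited vis v) visitedB
    ; startA = startA
    ; countA = countA ; countB = cong suc countB
    ; over = giveTurn-sound _ pa v true ca (suc cb) }
    where
    open History h
    pv = proj₁ (∈-movesFrom⁻ v∈)
    v∉A = free-∉ visitedA (proj₂ (∈-movesFrom⁻ v∈))
    v∉B = free-∉ visitedB (proj₂ (∈-movesFrom⁻ v∈))

  history-run : ∀ {a k s f} → History a s → RationalRun k s f → History a f
  history-run h (finished _) = h
  history-run h (move v v∈ _ run) = history-run (history-step h v∈) run

  -- the trails are disjoint paths, so at most n vertices have been traversed
  played : State n → ℕ
  played s = cntA s + cntB s

  history-played≤ : ∀ {a s} → History a s → played s ≤ n
  history-played≤ {a} {s} h = subst (_≤ n) counts
    (unique-length≤ (Unique.++⁺ (proj₁ pathA) (proj₁ pathB) disjoint))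
    where
    open History h
    counts : length ((posA s ∷ pastA) ++ (posB s ∷ pastB)) ≡ played s
    counts = trans (length-++ (posA s ∷ pastA)) (sym (cong₂ _+_ countA countB))

  minOver-≤ : ∀ {A : Set} (xs : List A) (f : A → ℚ) {x} → x ∈ xs → minOver xs f ≤ℚ f x
  minOver-≤ (_ ∷ []) f (here refl) = ℚ.≤-refl
  minOver-≤ (y ∷ _ ∷ _) f (here refl) = ℚ.p⊓q≤p (f y) _
  minOver-≤ (y ∷ z ∷ zs) f (there x∈) = ℚ.≤-trans (ℚ.p⊓q≤q (f y) _) (minOver-≤ (z ∷ zs) f x∈)

  minOver-glb : ∀ {A : Set} y (ys : List A) (f : A → ℚ) {q} → (∀ {x} → x ∈ y ∷ ys → q ≤ℚ f x) → q ≤ℚ minOver (y ∷ ys) f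
  minOver-glb y [] f lower = lower (here refl)
  minOver-glb y (z ∷ zs) f lower = ℚ.⊓-glb (lower (here refl)) (minOver-glb z zs f (lower ∘ there))

  maxOver-≥ : ∀ {A : Set} (xs : List A) (f : A → ℚ) {x} → x ∈ xs → f x ≤ℚ maxOver xs f
  maxOver-≥ (_ ∷ []) f (here refl) = ℚ.≤-refl
  maxOver-≥ (y ∷ _ ∷ _) f (here refl) = ℚ.p≤p⊔q (f y) _
  maxOver-≥ (y ∷ z ∷ zs) f (there x∈) = ℚ.≤-trans (maxOver-≥ (z ∷ zs) f x∈) (ℚ.p≤q⊔p (f y) _)

  maxOver-lub : ∀ {A : Set} y (ys : List A) (f : A → ℚ) {q} → (∀ {x} → x ∈ y ∷ ys → f x ≤ℚ q) → maxOver (y ∷ ys) f ≤ℚ q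
  maxOver-lub y [] f upper = upper (here refl)
  maxOver-lub y (z ∷ zs) f upper = ℚ.⊔-lub (upper (here refl)) (maxOver-lub z zs f (upper ∘ there))

  value-stuck : ∀ k s → movesCur s ≡ [] → value k s ≡ outcome s
  value-stuck zero s _ = refl
  value-stuck (suc k) s stuck with movesCur s
  ... | [] = refl
  value-stuck (suc k) s () | _ ∷ _

  value-min≤ : ∀ {k s v} → aliceTurn s ≡ true → v ∈ movesCur s → value (suc k) s ≤ℚ value k (step s v)
  value-min≤ {k} {s} refl v∈ with movesCur s
  ... | m ∷ ms = minOver-≤ (m ∷ ms) _ v∈

  value-min-glb : ∀ {k s q} → aliceTurn s ≡ true → (movesCur s ≡ [] → q ≤ℚ outcome s) →
                  (∀ {v} → v ∈ movesCur s → q ≤ℚ value k (step s v)) → q ≤ℚ value (suc k) s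
  value-min-glb {k} {s} refl stuck lower with movesCur s
  ... | [] = stuck refl
  ... | m ∷ ms = minOver-glb m ms _ lower

  value-max≥ : ∀ {k s v} → aliceTurn s ≡ false → v ∈ movesCur s → value k (step s v) ≤ℚ value (suc k) s
  value-max≥ {k} {s} refl v∈ with movesCur s
  ... | m ∷ ms = maxOver-≥ (m ∷ ms) _ v∈

  value-max-lub : ∀ {k s q} → aliceTurn s ≡ false → (movesCur s ≡ [] → outcome s ≤ℚ q) →
                  (∀ {v} → v ∈ movesCur s → value k (step s v) ≤ℚ q) → value (suc k) s ≤ℚ q
  value-max-lub {k} {s} refl stuck upper with movesCur s
  ... | [] = stuck refl
  ... | m ∷ ms = maxOver-lub m ms _ upper

  -- along a rational run the value does not change, so it is the outcome of the final position
  value-run : ∀ {k s f} → RationalRun k s f → value k s ≡ outcome f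
  value-run {k} {s} (finished stuck) = value-stuck k s stuck
  value-run (move v _ optimal run) = trans (sym optimal) (value-run run)

  -- a route R for a player standing at `me`: a path of free vertices leaving `me` that the
  -- opponent standing at `opp` cannot reach through free vertices, so it stays free whatever happens
  record SafeRoute (vis : Fin n → Bool) (me opp : Fin n) (R : List (Fin n)) : Set where
    field
      route : IsPath G (me ∷ R)
      free : All (Free vis) R
      unreachable : ∀ {x} → x ∈ R → ¬ Walk (Free vis) opp x

  route-stuck : ∀ {vis me opp R} → SafeRoute vis me opp R → movesFrom vis me ≡ [] → R ≡ []
  route-stuck {R = []} _ _ = refl
  route-stuck {R = r ∷ _} sr stuck with subst (r ∈_) stuck (∈-movesFrom⁺ (Linked.head (proj₂ route)) (All.head free))
    where open SafeRoute sr
  ... | ()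

  route-follow : ∀ {vis me opp R m} → SafeRoute vis me opp R → m ∈ movesFrom vis me →
                 ∃ λ v → v ∈ movesFrom vis me × ∃ λ R′ → SafeRoute (mark vis v) v opp R′ × length R ≤ suc (length R′)
  route-follow {R = []} _ m∈ = _ , m∈ , [] , record { route = ([] ∷ []) , [-] ; free = [] ; unreachable = λ () } , z≤n
  route-follow {vis} {R = r ∷ R′} sr _ =
    r , ∈-movesFrom⁺ (Linked.head (proj₂ route)) (All.head free) , R′ ,
    record
      { route = path-suffix [ _ ] route
      ; free = All.tabulate (λ {x} x∈ → trans (mark-other vis (distinct x∈)) (All.lookup free (there x∈)))
      ; unreachable = λ x∈ walk → unreachable (there x∈) (walk-weaken (mark-free vis r) walk) }
    , ℕ.≤-refl
    where
    open SafeRoute sr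
    distinct : ∀ {x} → x ∈ R′ → x ≢ r
    distinct x∈ = ≢-sym (All.lookup (AllPairs.head (AllPairs.tail (proj₁ route))) x∈)

  route-opponent : ∀ {vis me opp R v} → SafeRoute vis me opp R → v ∈ movesFrom vis opp → SafeRoute (mark vis v) me v R
  route-opponent {vis} {v = v} sr v∈ = record
    { route = route
    ; free = All.tabulate (λ {x} x∈ → trans (mark-other vis (λ x≡v → unreachable x∈ (reach x≡v))) (All.lookup free x∈))
    ; unreachable = λ x∈ walk → unreachable x∈ (go ov vfree (walk-weaken (mark-free vis v) walk)) }
    where
    open SafeRoute sr
    ov = proj₁ (∈-movesFrom⁻ v∈)
    vfree = proj₂ (∈-movesFrom⁻ v∈)
    reach : ∀ {x} → x ≡ v → Walk (Free vis) _ x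
    reach refl = go ov vfree stay

  -- every move uses up one unit of look-ahead and one new vertex; since at most n vertices are ever
  -- traversed, a look-ahead with k + played s > n never runs out before the game ends
  budget-step : ∀ k s v → n < suc k + played s → n < k + played (step s v)
  budget-step k (st _ _ _ true ca cb) v budget = subst (n <_) (sym (ℕ.+-suc k (ca + cb))) budget
  budget-step k (st _ _ _ false ca cb) v budget =
    subst (n <_) (sym (trans (cong (λ y → k + y) (ℕ.+-suc ca cb)) (ℕ.+-suc k (ca + cb)))) budget

  budget-positive : ∀ {a s} → History a s → ¬ n < 0 + played s
  budget-positive h budget = ℕ.<⇒≱ budget (history-played≤ h)

  -- if Alice has a safe route whose end brings her count to `target`, and every such position has
  -- outcome at most q, then the value is at most q: Alice follows the route whatever Bob does
  module AliceFollowsRoute (a : Fin n) (target : ℕ) (q : ℚ)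
    (enough : ∀ {s} → History a s → target ≤ cntA s → outcome s ≤ℚ q) where

    -- a stuck player has used up the route, so the target is reached
    finish : ∀ {s R} → History a s → SafeRoute (visited s) (posA s) (posB s) R →
             movesFrom (visited s) (posA s) ≡ [] → target ≤ cntA s + length R → outcome s ≤ℚ q
    finish {s} h sr stuck reached with route-stuck sr stuck
    ... | refl = enough h (subst (target ≤_) (ℕ.+-identityʳ (cntA s)) reached)

    guarantee : ∀ k s R → History a s → n < k + played s → SafeRoute (visited s) (posA s) (posB s) R →
                target ≤ cntA s + length R → value k s ≤ℚ q
    guarantee zero s R h budget _ _ = contradiction budget (budget-positive h)
    guarantee (suc k) s@(st vis pa pb true ca cb) R h budget sr reached with empty-or-member (movesFrom vis pa)
    ... | inj₁ stuck = ℚ.≤-trans (ℚ.≤-reflexive (value-stuck (suc k) s stuck)) (finish h sr stuck reached)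
    ... | inj₂ (_ , m∈) with route-follow sr m∈
    ...   | v , v∈ , R′ , sr′ , shorter =
      ℚ.≤-trans (value-min≤ refl v∈)
        (guarantee k (step s v) R′ (history-step h v∈) (budget-step k s v budget) sr′
          (target-step reached shorter))
    guarantee (suc k) s@(st vis pa pb false ca cb) R h budget sr reached =
      value-max-lub refl (λ stuck → finish h sr (proj₁ (History.over h stuck)) reached)
        λ {v} v∈ → guarantee k (step s v) R (history-step h v∈) (budget-step k s v budget) (route-opponent sr v∈) reached

  module BobFollowsRoute (a : Fin n) (target : ℕ) (q : ℚ)
    (enough : ∀ {s} → History a s → target ≤ cntB s → q ≤ℚ outcome s) where

    finish : ∀ {s R} → History a s → SafeRoute (visited s) (posB s) (posA s) R →
             movesFrom (visited s) (posB s) ≡ [] → target ≤ cntB s + length R → q ≤ℚ outcome s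
    finish {s} h sr stuck reached with route-stuck sr stuck
    ... | refl = enough h (subst (target ≤_) (ℕ.+-identityʳ (cntB s)) reached)

    guarantee : ∀ k s R → History a s → n < k + played s → SafeRoute (visited s) (posB s) (posA s) R →
                target ≤ cntB s + length R → q ≤ℚ value k s
    guarantee zero s R h budget _ _ = contradiction budget (budget-positive h)
    guarantee (suc k) s@(st vis pa pb false ca cb) R h budget sr reached with empty-or-member (movesFrom vis pb)
    ... | inj₁ stuck = ℚ.≤-trans (finish h sr stuck reached) (ℚ.≤-reflexive (sym (value-stuck (suc k) s stuck)))
    ... | inj₂ (_ , m∈) with route-follow sr m∈
    ...   | v , v∈ , R′ , sr′ , shorter =
      ℚ.≤-trans
        (guarantee k (step s v) R′ (history-step h v∈) (budget-step k s v budget) sr′ (target-step reached shorter))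
        (value-max≥ refl v∈)
    guarantee (suc k) s@(st vis pa pb true ca cb) R h budget sr reached =
      value-min-glb refl (λ stuck → finish h sr (proj₂ (History.over h stuck)) reached)
        λ {v} v∈ → guarantee k (step s v) R (history-step h v∈) (budget-step k s v budget) (route-opponent sr v∈) reached

  alice-trail : ∀ {a s} → History a s → ∃ λ xs → PathFrom a xs × length xs ≡ cntA s
  alice-trail {a} {s} h with History.startA h
  ... | ini , ends =
    reverse (posA s ∷ pastA) , (reverse-path pathA , (reverse ini , trans (cong reverse ends) (reverse-++ ini [ a ]))) ,
    trans (length-reverse (posA s ∷ pastA)) (sym countA)
    where open History h

  bob-trail : ∀ {a s} → History a s → ∃ λ xs → IsPath G xs × length xs ≡ cntB s
  bob-trail {s = s} h = posB s ∷ pastB , pathB , sym countB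
    where open History h

  alice-count : ∀ {a s} → History a s → suc (cntA s ∸ 1) ≡ cntA s
  alice-count h rewrite History.countA h = refl

  -- in a tree, from a vertex a one cannot reach through free vertices anything beyond a visited
  -- neighbour p: a path a ∷ p ∷ R and a free walk from a to R would close a cycle through a
  behind-visited-neighbour : Acyclic G → ∀ {vis a p R x} → Visited vis a → Visited vis p →
                             IsPath G (a ∷ p ∷ R) → x ∈ R → ¬ Walk (Free vis) a x
  behind-visited-neighbour _ _ _ ((a∉ ∷ _) , _) x∈ stay = All.lookup (All.tail a∉) x∈ refl
  behind-visited-neighbour acyclic visitedA visitedP ((a∉ ∷ _) , ap ∷ linked) x∈ (go az zfree z⇝x) =
    tree-separation acyclic az ap (free⇒≢ zfree visitedP)
      (walk-weaken (λ free → free⇒≢ free visitedA) z⇝x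
        ++ʷ walk-reverse (≢-sym (All.head a∉)) (linked-walk linked (All.map ≢-sym (All.tail a∉)) (there x∈)))

  opponents : Fin n → List (Fin n)
  opponents a = filterᵇ (λ b → not ⌊ b ≟ a ⌋) (allFin n)

  ∈-opponents⁺ : ∀ {a b} → a ≢ b → b ∈ opponents a
  ∈-opponents⁺ {a} {b} a≢b = ∈-filter⁺ (Bool.T? ∘ λ b → not ⌊ b ≟ a ⌋) (∈-allFin b) (T-not-≢ (≢-sym a≢b))
    where
    T-not-≢ : b ≢ a → T (not ⌊ b ≟ a ⌋)
    T-not-≢ b≢a with b ≟ a
    ... | yes b≡a = b≢a b≡a
    ... | no _ = tt

  ∈-opponents⁻ : ∀ {a b} → b ∈ opponents a → a ≢ b
  ∈-opponents⁻ {a} {b} b∈ with b ≟ a | proj₂ (∈-filter⁻ (Bool.T? ∘ λ b → not ⌊ b ≟ a ⌋) {xs = allFin n} b∈)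
  ... | no b≢a | _ = ≢-sym b≢a

  -- Bob's answer to Alice's start a: start next to a on a longest path from a and walk it away from her.
  -- If that path has L + 1 vertices, Bob traverses L of them while Alice, whose trail is also a path
  -- from a, traverses at most L + 1; so the value of a is at least L/(L+1)
  bob-follows-longest-path : Acyclic G → Connected G → ∀ {a b} → a ≢ b →
    ∃ λ L → (∀ {s} → History a s → cntA s ≤ suc L) × (+ L / suc L ≤ℚ startValue a)
  bob-follows-longest-path acyclic connected {a} {b} a≢b with connected a b
  ... | _ , pathV , (rest , refl) , (ini , ends)
    with longest (PathFrom a) (λ xs → isPath? xs ×-dec startsAt? a xs) (proj₁ ∘ proj₁) (pathV , rest , refl)
  -- Q has a second vertex, since the path from a to b ≢ a has
  ... | _ , (pathQ , [] , refl) , maximal =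
    contradiction (ℕ.≤-trans (ends-distinct-long rest ini a≢b ends) (maximal (pathV , rest , refl))) λ { (s≤s ()) }
  ... | _ , (pathQ@((a∉Q ∷ p₁∉R ∷ _) , _) , p₁ ∷ R , refl) , maximal =
    L , alice-bound , ℚ.≤-trans bob-secures (maxOver-≥ (opponents a) _ (∈-opponents⁺ a≢p₁))
    where
    L = suc (length R)
    a≢p₁ = All.head a∉Q
    a∉R = All.tail a∉Q
    vis₀ = visited (initial a p₁)

    alice-bound : ∀ {s} → History a s → cntA s ≤ suc L
    alice-bound h with alice-trail h
    ... | _ , from , len = subst (_≤ suc L) len (maximal from)

    route : SafeRoute vis₀ p₁ a R
    route = record
      { route = path-suffix [ a ] pathQ
      ; free = All.tabulate (λ x∈ → initial-free a p₁ (≢-sym (All.lookup a∉R x∈)) (≢-sym (All.lookup p₁∉R x∈)))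
      ; unreachable = behind-visited-neighbour acyclic (initial-visitedA a p₁) (initial-visitedB a p₁) pathQ }

    enough : ∀ {s} → History a s → L ≤ cntB s → + L / suc L ≤ℚ outcome s
    enough {s} h L≤B = ratio-≤ L L (cntB s) (cntA s ∸ 1)
      (ℕ.≤-trans (ℕ.*-monoʳ-≤ L (subst (_≤ suc L) (sym (alice-count h)) (alice-bound h))) (ℕ.*-monoˡ-≤ (suc L) L≤B))

    bob-secures : + L / suc L ≤ℚ value n (initial a p₁)
    bob-secures = BobFollowsRoute.guarantee a L _ enough n (initial a p₁) R (history-initial a≢p₁) (ℕ.m<m+n n z<s) route ℕ.≤-refl

  -- if c has two disjoint branches U, W with at least m vertices each, and q bounds the outcome once
  -- Alice has m + 1 vertices, then q bounds the value of any start b of Bob: as c is visited, b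
  -- reaches at most one branch through free vertices, and Alice follows the other one
  alice-escapes-along-a-branch : Acyclic G → ∀ {c b U W m q} → c ≢ b →
    IsPath G (c ∷ U) → IsPath G (c ∷ W) → Disjoint U W → m ≤ length U → m ≤ length W →
    (∀ {s} → History c s → suc m ≤ cntA s → outcome s ≤ℚ q) → value n (initial c b) ≤ℚ q
  alice-escapes-along-a-branch acyclic {c} {b} {U} {W} {m} {q} c≢b pathU pathW disjoint longU longW enough =
    -- the goal is decidable, so Alice may argue by contradiction about which branch is safe
    decidable-stable (value n (initial c b) ℚ.≤? q) λ above →
      above (follow U pathU longU λ x∈ b⇝x →
        above (follow W pathW longW λ y∈ b⇝y → separated x∈ y∈ b⇝x b⇝y))
    where
    vis₀ = visited (initial c b)

    follow : ∀ R → IsPath G (c ∷ R) → m ≤ length R → (∀ {x} → x ∈ R → ¬ Walk (Free vis₀) b x) →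
             value n (initial c b) ≤ℚ q
    follow R pathR long unreachable =
      AliceFollowsRoute.guarantee c (suc m) q enough n (initial c b) R (history-initial c≢b) (ℕ.m<m+n n z<s)
        record { route = pathR ; unreachable = unreachable
               ; free = All.tabulate λ x∈ → initial-free c b (≢-sym (All.lookup (AllPairs.head (proj₁ pathR)) x∈))
                                                            λ { refl → unreachable x∈ stay } }
        (s≤s long)

    separated : ∀ {x y} → x ∈ U → y ∈ W → Walk (Free vis₀) b x → Walk (Free vis₀) b y → ⊥
    separated x∈ y∈ b⇝x b⇝y =
      branches-separated acyclic pathU pathW disjoint x∈ y∈ (walk-reverse (≢-sym c≢b) (avoid b⇝x) ++ʷ avoid b⇝y)
      where
      avoid = walk-weaken (λ free → free⇒≢ free (initial-visitedA c b))

  two : ℚ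
  two = + 2 / 1

  -- Alice's start: the middle vertex c of a longest path P = pre ++ c ∷ suf. Bob's trail is a path, so
  -- he traverses at most |P| ≤ 2 (|pre| + 1) vertices. In a tree his start b cannot reach both sides of c
  -- through free vertices, and Alice walks along a side he cannot reach, traversing at least |pre| + 1
  alice-takes-middle : Acyclic G → Fin n → ∃ λ c → startValue c ≤ℚ two
  alice-takes-middle acyclic a with longest (IsPath G) isPath? proj₁ {[ a ]} (([] ∷ []) , [-])
  -- P is nonempty, as the one-vertex path [ a ] is no longer than P
  ... | [] , _ , maximal = contradiction (maximal {[ a ]} (([] ∷ []) , [-])) λ ()
  ... | x ∷ xs , pathP , maximal with middle-split x xs
  ... | pre , c , suf , split , shortLeft , shortRight = c , startValue≤two
    where
    m = length pre
    pathP′ : IsPath G (pre ++ c ∷ suf)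
    pathP′ = subst (IsPath G) split pathP

    lengthP : length (x ∷ xs) ≡ suc (m + length suf)
    lengthP = trans (cong length split) (trans (length-++ pre) (ℕ.+-suc m (length suf)))

    -- the two sides of c, both read away from c
    Left = reverse pre
    pathLeft : IsPath G (c ∷ Left)
    pathLeft = subst (IsPath G) (reverse-++ pre [ c ])
      (reverse-path (path-prefix (pre ++ [ c ]) (subst (IsPath G) (sym (++-assoc pre [ c ] suf)) pathP′)))
    pathRight : IsPath G (c ∷ suf)
    pathRight = path-suffix pre pathP′
    sides-disjoint : Disjoint Left suf
    sides-disjoint (u∈ , u∈′) = unique-++-distinct pre (proj₁ pathP′) (Any.reverse⁻ u∈) (there u∈′) refl

    enough : ∀ {s} → History c s → suc m ≤ cntA s → outcome s ≤ℚ two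
    enough {s} h reached with bob-trail h
    ... | trail , pathB , lenB = ratio-≤ (cntB s) (cntA s ∸ 1) 2 0 (begin
      cntB s * 1               ≡⟨ ℕ.*-identityʳ (cntB s) ⟩
      cntB s                   ≡⟨ sym lenB ⟩
      length trail             ≤⟨ maximal pathB ⟩
      length (x ∷ xs)          ≡⟨ lengthP ⟩
      suc (m + length suf)     ≤⟨ s≤s (ℕ.+-monoʳ-≤ m shortRight) ⟩
      suc (m + suc m)          ≡⟨ cong (λ y → suc (m + y)) (sym (ℕ.+-identityʳ (suc m))) ⟩
      2 * suc m                ≤⟨ ℕ.*-monoʳ-≤ 2 reached ⟩
      2 * cntA s               ≡⟨ cong (2 *_) (sym (alice-count h)) ⟩
      2 * suc (cntA s ∸ 1)     ∎)
      where open ℕ.≤-Reasoning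

    startValue≤two : startValue c ≤ℚ two
    startValue≤two with opponents c | ∈-opponents⁻ {c}
    ... | [] | _ = ratio-≤ 0 0 2 0 z≤n
    ... | b ∷ bs | opponent = maxOver-lub b bs _ λ b∈ →
      alice-escapes-along-a-branch acyclic (opponent b∈) pathLeft pathRight sides-disjoint
        (ℕ.≤-reflexive (sym (length-reverse pre))) shortLeft enough

  alice-at-most-one-ahead : IsTree G → ∀ {a b s} → a ≢ b → History a s → outcome s ≡ startValue a →
                            cntA s ≤ cntB s + 1
  alice-at-most-one-ahead (connected , acyclic) {s = s} a≢b h realised
    with bob-follows-longest-path acyclic connected a≢b
  ... | L , alice-bound , lower =
    subst₂ _≤_ (alice-count h) (ℕ.+-comm 1 (cntB s))
      (s≤s (near-one-ratio (ℕ.∸-monoˡ-≤ 1 (alice-bound h))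
                           (ratio-≤⁻ L L (cntB s) (cntA s ∸ 1) (subst (_ ≤ℚ_) (sym realised) lower))))

  bob-at-most-double : Acyclic G → ∀ {a s} → History a s → startValue a ≡ minOver (allFin n) startValue →
                       outcome s ≡ startValue a → cntB s ≤ 2 * cntA s
  bob-at-most-double acyclic {a} {s} h optimal realised with alice-takes-middle acyclic a
  ... | c , c≤two =
    subst₂ _≤_ (ℕ.*-identityʳ (cntB s)) (cong (2 *_) (alice-count h))
      (ratio-≤⁻ (cntB s) (cntA s ∸ 1) 2 0 (subst (_≤ℚ two) (sym realised) a≤two))
    where
    a≤two : startValue a ≤ℚ two
    a≤two = ℚ.≤-trans (subst (_≤ℚ startValue c) (sym optimal) (minOver-≤ (allFin n) startValue (∈-allFin c))) c≤two

lemma3 : (n : ℕ) (T : Graph n) → 2 ≤ n → IsTree T →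
    ∀ (A B : ℕ) → Tron.RationalPlay T A B → A ≤ B + 1 × B ≤ 2 * A
lemma3 n T _ tree A B (a , b , a≢b , a-optimal , b-optimal , f , run , refl , refl) =
  alice-at-most-one-ahead tree a≢b history realised , bob-at-most-double (proj₂ tree) history a-optimal realised
  where
  open Tron T
  open Game T
  history : History a f
  history = history-run (history-initial a≢b) run
  -- both players play optimally, so the final outcome is the value of Alice's start
  realised : outcome f ≡ startValue a
  realised = trans (sym (value-run run)) b-optimal
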